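{- Let $n\ge 4$. The poset $X(n)$ is not autonomous.
   Context: A simple pseudo-graph is a finite graph that may have loops but no multiple edges; its edge set $E(G)\subseteq V(G)\times V(G)$ is a symmetric relation, and $v$ is looped iff $vv\in E(G)$. Write $N(v)=\{w: vw\in E(G)\}$. An OSP-graph is a simple pseudo-graph whose vertex set is a finite set of positive integers with the usual order. Pressing a looped vertex $v$ produces $G_{(v)}$ with vertex set $V(G)$ and edge set $E(G)\,\triangle\,(N(v)\times N(v))$; $G_{(v_1,\dots,v_k)}$ denotes successive pressing. A successful pressing sequence is a sequence $(v_1,\dots,v_k)$ with each $v_i$ looped in $G_{(v_1,\dots,v_{i-1})}$ and $G_{(v_1,\dots,v_k)}$ having no edges and no loops; $\Sigma(G)$ is their set. $G$ is full-rank if its adjacency matrix (diagonal entry $1$ at looped vertices) is invertible over $\mathbb{F}_2$. For full-rank $G$ on $n$ vertices and $\sigma=(v_1,\dots,v_n)\in\Sigma(G)$, let $U$ be the upper-triangular $0/1$ matrix with $U[i,j]=1$ iff $i\le j$ and $v_iv_j\in E(G_{(v_1,\dots,v_{i-1})})$, $D$ the digraph on $V(G)$ with arc $v_i\to v_j$ whenever $U[i,j]=1$, and $\mathcal{P}(G,\sigma)=(V(G),\preceq)$ the instructional poset with $y\preceq x$ iff there is a directed path (possibly of length $0$) from $x$ to $y$ in $D$. A linear extension of a poset is a listing $(\tau_1,\dots,\tau_n)$ of its elements with $\tau_i\succ\tau_j\Rightarrow i<j$; $\mathrm{LinExt}(\mathcal{P})$ is their set. A finite poset $\mathcal{P}$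 is autonomous if there exist a full-rank OSP-graph $G$ and $\sigma\in\Sigma(G)$ with $\mathcal{P}(G,\sigma)$ isomorphic to $\mathcal{P}$ and $\Sigma(G)=\mathrm{LinExt}(\mathcal{P}(G,\sigma))$. $X(n)$ is the poset on $[n]$ whose cover relations are: $1$ covers $3$, $n-2$ covers $n$, and $i$ covers $i+1$ for all $i\in\{2,\dots,n-2\}$ (two maximal elements $1,2$ above a chain ending in two minimal elements $n-1,n$). -}

module Defs where

open import Data.Nat using (ℕ; zero; suc; _≤_; _<_; _∸_)
open import Data.Fin using (Fin; toℕ) renaming (zero to fz; suc to fs)
open import Data.Bool using (Bool; true; false; _∧_; _xor_)
open import Data.List using (List; []; _∷_; length; take; lookup)
open import Data.List.Relation.Unary.Unique.Propositional using (Unique)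
open import Data.List.Membership.Propositional using (_∈_)
open import Data.Product using (Σ; _×_; ∃)
open import Data.Sum using (_⊎_)
open import Relation.Binary.PropositionalEquality using (_≡_; _≢_)
open import Relation.Binary.Construct.Closure.ReflexiveTransitive using (Star)
open import Function.Bundles using (_⇔_)
open import Function.Definitions using (Bijective)

-- Simple pseudo-graphs on the vertex type Fin m, given by a symmetric
-- Boolean adjacency relation (A v v ≡ true iff v is looped).

Adj : ℕ → Set
Adj m = Fin m → Fin m → Bool

-- An OSP-graph: a finite set of positive integers as vertex set
-- (listed increasingly by `label`, so vertex i of Fin m is the positive
-- integer `label i`) together with a symmetric adjacency relation.
record OSPGraph : Set where
  field
    m        : ℕ
    label    : Fin m → ℕ
    labelPos : ∀ i → 1 ≤ label i
    labelInc : ∀ i j → toℕ i < toℕ j → label i < label j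
    adj      : Adj m
    adjSym   : ∀ i j → adj i j ≡ adj j i
open OSPGraph public

press : ∀ {m} → Adj m → Fin m → Adj m
press A v i j = A i j xor (A v i ∧ A v j)

pressSeq : ∀ {m} → Adj m → List (Fin m) → Adj m
pressSeq A []       = A
pressSeq A (v ∷ vs) = pressSeq (press A v) vs

Successful : ∀ {m} → Adj m → List (Fin m) → Set
Successful A []       = ∀ i j → A i j ≡ false
Successful A (v ∷ vs) = (A v v ≡ true) × Successful (press A v) vs

sumF₂ : ∀ {k} → (Fin k → Bool) → Bool
sumF₂ {zero}  f = false
sumF₂ {suc k} f = f fz xor sumF₂ (λ i → f (fs i))

matMul : ∀ {m} → Adj m → Adj m → Adj m
matMul A B i j = sumF₂ (λ k → A i k ∧ B k j)

idMat : ∀ {m} → Adj m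
idMat fz     fz     = true
idMat fz     (fs _) = false
idMat (fs _) fz     = false
idMat (fs i) (fs j) = idMat i j

FullRank : OSPGraph → Set
FullRank G = Σ (Adj (m G)) λ B →
  (∀ i j → matMul (adj G) B i j ≡ idMat i j) ×
  (∀ i j → matMul B (adj G) i j ≡ idMat i j)

-- Instructional poset P(G, σ).  Positions in σ are 0-based, so the graph
-- G_(v_1,...,v_{i-1}) for the i-th entry is pressSeq A (take i σ).

Arc : ∀ {m} → Adj m → List (Fin m) → Fin m → Fin m → Set
Arc A σ x y = Σ (Fin (length σ)) λ i → Σ (Fin (length σ)) λ j →
  (toℕ i ≤ toℕ j) × (lookup σ i ≡ x) × (lookup σ j ≡ y) ×
  (pressSeq A (take (toℕ i) σ) x y ≡ true)

-- PLe A σ a b : a ⪯ b, i.e. directed path (length ≥ 0) from b to a in D.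
PLe : ∀ {m} → Adj m → List (Fin m) → Fin m → Fin m → Set
PLe A σ a b = Star (Arc A σ) b a

LinExt : ∀ {m} → (Fin m → Fin m → Set) → List (Fin m) → Set
LinExt {m} _≤P_ τ =
  Unique τ × (∀ x → x ∈ τ) ×
  (∀ (i j : Fin (length τ)) →
     (lookup τ j ≤P lookup τ i) → lookup τ i ≢ lookup τ j → toℕ i < toℕ j)

Autonomous : (k : ℕ) → (Fin k → Fin k → Set) → Set
Autonomous k _≤Q_ = Σ OSPGraph λ G → FullRank G ×
  Σ (List (Fin (m G))) λ σ → Successful (adj G) σ ×
    (Σ (Fin (m G) → Fin k) λ f → Bijective _≡_ _≡_ f ×
       (∀ a b → PLe (adj G) σ a b ⇔ (f a ≤Q f b))) ×
    (∀ τ → Successful (adj G) τ ⇔ LinExt (PLe (adj G) σ) τ)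

-- The poset X(n) on [n] = {1,...,n}; element t : Fin n stands for toℕ t + 1.
-- XCover n a b : a covers b.

XCover : ℕ → ℕ → ℕ → Set
XCover n a b =
  (a ≡ 1 × b ≡ 3) ⊎
  (a ≡ n ∸ 2 × b ≡ n) ⊎
  (2 ≤ a × a ≤ n ∸ 2 × b ≡ suc a)

XLe : (n : ℕ) → Fin n → Fin n → Set
XLe n s t = Star (XCover n) (suc (toℕ t)) (suc (toℕ s))

-- Let G and σ witness that X(n) is autonomous, and read off the element of X(n) pressed at each
-- position of σ.  Fix four consecutive positions of σ and the graph B just before they are
-- pressed.  Entry (i, j) of the graph after these four presses depends only on the 4 × 4 block of
-- B they span, on the rows of i and j towards them and on B i j.  An exhaustive search over the 2¹⁰
-- symmetric blocks shows that, unless the block has a certain property, some reordering of the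
-- four presses is also admissible, yields the same graph for every choice of i, j, rows and entry,
-- and puts two comparable elements in the wrong order: a successful pressing sequence that is not
-- a linear extension, contradicting autonomy.
--
-- For n = 4 the window is all of σ and no block has the property.  For n ≥ 5, σ is itself a
-- linear extension of X(n), so its first two positions carry the maximal elements, the next n − 4
-- the chain in order and the last two the minimal elements; two positions are comparable unless
-- they are the first two or the last two.  The searches then show, for the instruction matrix U,
-- that U[2,4] = 1 (first window), that U[s,s+2] = 1 forces U[s+1,s+3] = 1 (middle windows) and
-- that U[n−3,n−1] = 0 (last window), which is absurd.

module Submission where

open import Defs
open import Data.Bool using (Bool; true; false; T; _∧_; _∨_; _xor_; not)
open import Data.Bool.ListAction using (any; all)
open import Data.Bool.Properties using (∧-comm; T-∧; T-∨; T-not-≡)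
open import Data.Empty using (⊥; ⊥-elim)
open import Data.Fin using (Fin; toℕ; zero; suc; fromℕ<; _≟_)
open import Data.Fin.Patterns using (0F; 1F; 2F; 3F; 4F; 5F; 6F; 7F; 8F; 9F)
open import Data.Fin.Properties using (toℕ-injective; toℕ<n; toℕ-fromℕ<; cantor-schröder-bernstein)
open import Data.List using (List; []; _∷_; _++_; map; take; drop; length; lookup; allFin; concatMap)
open import Data.List.Membership.Propositional using (_∈_; find)
open import Data.List.Membership.Propositional.Properties using (∈-allFin; ∈-++⁺ˡ; ∈-++⁺ʳ; ∈-map⁺; ∈-lookup)
open import Data.List.Properties using (map-∘; map-++; ++-assoc; take-[]; take++drop≡id)
open import Data.List.Relation.Unary.All as All using (All; []; _∷_)
open import Data.List.Relation.Unary.All.Properties using (all⁺; map⁺)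
open import Data.List.Relation.Unary.AllPairs using (_∷_)
open import Data.List.Relation.Unary.Any using (here; there; index)
open import Data.List.Relation.Unary.Any.Properties using (any⁻; lookup-index; ++⁺ˡ; ++⁺ʳ)
open import Data.List.Relation.Unary.Unique.Propositional using (Unique)
open import Data.Nat using (ℕ; zero; suc; _+_; _∸_; _≤_; _<_; _<ᵇ_; z≤n; s≤s; s≤s⁻¹; _≤?_; _<?_)
open import Data.Nat.Properties
  using (≤-refl; ≤-trans; ≤-antisym; <-irrefl; <-asym; ≤-<-trans; <-≤-trans; <⇒≤; <⇒≱; ≰⇒>; ≮⇒≥;
         m≤n⇒m<n∨m≡n; n≤1+n; 0≢1+n; 1+n≢0; 1+n≢n; m≤m+n; m≤n+m; m+[n∸m]≡n; +-comm;
         +-identityʳ; +-suc; +-mono-≤; +-monoˡ-≤; +-monoʳ-≤; +-monoˡ-<; <ᵇ⇒<; <⇒<ᵇ)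
open import Data.Product using (∃; ∃-syntax; _×_; _,_; proj₁; proj₂)
open import Data.Sum using (_⊎_; inj₁; inj₂; [_,_]′)
open import Data.Unit using (⊤; tt)
open import Data.Vec using (Vec; []; _∷_; tabulate)
import Data.Vec as Vec
open import Data.Vec.Properties using (lookup∘tabulate)
open import Function using (_∘_; _∘′_)
open import Function.Bundles using (_⇔_; Equivalence)
open import Function.Definitions using (Bijective)
open import Relation.Binary.Construct.Closure.ReflexiveTransitive using (Star; ε; _◅_; _◅◅_)
open import Relation.Nullary using (¬_; yes; no)
open import Relation.Nullary.Decidable using (T?; decidable-stable; toWitness; ⌊_⌋)
open import Relation.Binary.PropositionalEquality
  using (_≡_; _≢_; refl; sym; trans; cong; cong₂; subst; subst₂; module ≡-Reasoning)

-- Pressing sequences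

≡true⇒T : ∀ {b} → b ≡ true → T b
≡true⇒T refl = tt

T⇒≡true : ∀ {b} → T b → b ≡ true
T⇒≡true {true} _ = refl

_≐_ : ∀ {m} → Adj m → Adj m → Set
C ≐ D = ∀ x y → C x y ≡ D x y

Symmetric : ∀ {m} → Adj m → Set
Symmetric A = ∀ x y → A x y ≡ A y x

press-symmetric : ∀ {m} {A : Adj m} → Symmetric A → ∀ v → Symmetric (press A v)
press-symmetric {A = A} A-sym v x y = cong₂ _xor_ (A-sym x y) (∧-comm (A v x) (A v y))

pressSeq-symmetric : ∀ {m} {A : Adj m} → Symmetric A → ∀ vs → Symmetric (pressSeq A vs)
pressSeq-symmetric A-sym []       = A-sym
pressSeq-symmetric A-sym (v ∷ vs) = pressSeq-symmetric (press-symmetric A-sym v) vs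

pressSeq-++ : ∀ {m} (A : Adj m) xs ys → pressSeq A (xs ++ ys) ≡ pressSeq (pressSeq A xs) ys
pressSeq-++ A []       ys = refl
pressSeq-++ A (x ∷ xs) ys = pressSeq-++ (press A x) xs ys

admissible : ∀ {m} → Adj m → List (Fin m) → Bool
admissible A []       = true
admissible A (v ∷ vs) = A v v ∧ admissible (press A v) vs

Agree : ∀ {m} → (Fin m → Fin m → Set) → Adj m → Adj m → Set
Agree P C D = ∀ x y → P x y → C x y ≡ D x y

PressClosed : ∀ {m} → (Fin m → Fin m → Set) → Fin m → Set
PressClosed P v = ∀ x y → P x y → P v x × P v y

pressSeq-agree : ∀ {m} {P} {C D : Adj m} vs → All (PressClosed P) vs → Agree P C D →
                 Agree P (pressSeq C vs) (pressSeq D vs)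
pressSeq-agree []       []                  agree = agree
pressSeq-agree (v ∷ vs) (v-closed ∷ closed) agree = pressSeq-agree vs closed λ x y xy →
  let vx , vy = v-closed x y xy in
  cong₂ _xor_ (agree x y xy) (cong₂ _∧_ (agree v x vx) (agree v y vy))

pressSeq-cong : ∀ {m} {C D : Adj m} → C ≐ D → ∀ vs → pressSeq C vs ≐ pressSeq D vs
pressSeq-cong C≐D vs x y =
  pressSeq-agree vs (All.universal (λ _ _ _ _ → tt , tt) vs) (λ x y _ → C≐D x y) x y tt

admissible-cong : ∀ {m} {C D : Adj m} → C ≐ D → ∀ vs → admissible C vs ≡ admissible D vs
admissible-cong C≐D []       = refl
admissible-cong C≐D (v ∷ vs) = cong₂ _∧_ (C≐D v v) (admissible-cong (pressSeq-cong C≐D (v ∷ [])) vs)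

successful-cong : ∀ {m} {C D : Adj m} → C ≐ D → ∀ vs → Successful D vs → Successful C vs
successful-cong C≐D []       empty       x y = trans (C≐D x y) (empty x y)
successful-cong C≐D (v ∷ vs) (looped , rest) =
  trans (C≐D v v) looped , successful-cong (pressSeq-cong C≐D (v ∷ [])) vs rest

successful-++⁻ : ∀ {m} (A : Adj m) xs {ys} → Successful A (xs ++ ys) →
                 T (admissible A xs) × Successful (pressSeq A xs) ys
successful-++⁻ A []       succ            = tt , succ
successful-++⁻ A (x ∷ xs) (looped , succ) =
  let adm , rest = successful-++⁻ (press A x) xs succ in
  Equivalence.from T-∧ (≡true⇒T looped , adm) , rest

successful-++⁺ : ∀ {m} (A : Adj m) xs {ys} → T (admissible A xs) →
                 Successful (pressSeq A xs) ys → Successful A (xs ++ ys)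
successful-++⁺ A []       _   succ = succ
successful-++⁺ A (x ∷ xs) adm succ =
  let looped , adm′ = Equivalence.to T-∧ adm in
  T⇒≡true looped , successful-++⁺ (press A x) xs adm′ succ

restrict : ∀ {k m} → Adj m → (Fin k → Fin m) → Adj k
restrict A h x y = A (h x) (h y)

pressSeq-restrict : ∀ {k m} (A : Adj m) (h : Fin k → Fin m) vs x y →
                    pressSeq (restrict A h) vs x y ≡ pressSeq A (map h vs) (h x) (h y)
pressSeq-restrict A h []       x y = refl
pressSeq-restrict A h (v ∷ vs) x y = pressSeq-restrict (press A (h v)) h vs x y

admissible-restrict : ∀ {k m} (A : Adj m) (h : Fin k → Fin m) vs →
                      admissible (restrict A h) vs ≡ admissible A (map h vs)
admissible-restrict A h []       = refl
admissible-restrict A h (v ∷ vs) = cong (A (h v) (h v) ∧_) (admissible-restrict (press A (h v)) h vs)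

toℕ-preimage : ∀ {n p} → p < n → ∃[ i ] toℕ {n} i ≡ p
toℕ-preimage p< = fromℕ< p< , toℕ-fromℕ< p<

module _ {A : Set} where

  nthOr : A → List A → ℕ → A
  nthOr d []       _       = d
  nthOr d (x ∷ xs) zero    = x
  nthOr d (x ∷ xs) (suc p) = nthOr d xs p

  lookup≡nthOr : ∀ d xs (i : Fin (length xs)) → lookup xs i ≡ nthOr d xs (toℕ i)
  lookup≡nthOr d (x ∷ xs) zero    = refl
  lookup≡nthOr d (x ∷ xs) (suc i) = lookup≡nthOr d xs i

  nthOr-drop : ∀ d xs st k → nthOr d xs (st + k) ≡ nthOr d (drop st xs) k
  nthOr-drop d xs       zero     k = refl
  nthOr-drop d []       (suc st) k = refl
  nthOr-drop d (x ∷ xs) (suc st) k = nthOr-drop d xs st k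

  take-+ : ∀ st k (xs : List A) → take (st + k) xs ≡ take st xs ++ take k (drop st xs)
  take-+ zero     k xs       = refl
  take-+ (suc st) k []       = sym (take-[] k)
  take-+ (suc st) k (x ∷ xs) = cong (x ∷_) (take-+ st k xs)

  ≤-length-drop : ∀ st k (xs : List A) → st + k ≤ length xs → k ≤ length (drop st xs)
  ≤-length-drop zero     k xs       k≤       = k≤
  ≤-length-drop (suc st) k (x ∷ xs) (s≤s k≤) = ≤-length-drop st k xs k≤

  index-++⁺ˡ : ∀ {x : A} {xs ys} (x∈ : x ∈ xs) → toℕ (index (++⁺ˡ {ys = ys} x∈)) < length xs
  index-++⁺ˡ (here _)  = s≤s z≤n
  index-++⁺ˡ (there p) = s≤s (index-++⁺ˡ p)

  index-++⁺ʳ : ∀ {y : A} xs {ys} (y∈ : y ∈ ys) → length xs ≤ toℕ (index (++⁺ʳ xs y∈))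
  index-++⁺ʳ []       _ = z≤n
  index-++⁺ʳ (_ ∷ xs) p = s≤s (index-++⁺ʳ xs p)

  unique⇒lookup-injective : ∀ {xs : List A} → Unique xs → ∀ i j → lookup xs i ≡ lookup xs j → i ≡ j
  unique⇒lookup-injective (_  ∷ _) zero    zero    _ = refl
  unique⇒lookup-injective (x∉ ∷ _) zero    (suc j) e = ⊥-elim (All.lookup x∉ (∈-lookup j) e)
  unique⇒lookup-injective (x∉ ∷ _) (suc i) zero    e = ⊥-elim (All.lookup x∉ (∈-lookup i) (sym e))
  unique⇒lookup-injective (_  ∷ u) (suc i) (suc j) e = cong suc (unique⇒lookup-injective u i j e)

  unique-++-apart : ∀ {x y : A} xs {ys} → Unique (xs ++ ys) → x ∈ xs → y ∈ ys → x ≢ y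
  unique-++-apart (_ ∷ xs) (x∉ ∷ _) (here refl) y∈ = All.lookup x∉ (∈-++⁺ʳ xs y∈)
  unique-++-apart (_ ∷ xs) (_ ∷ u)  (there x∈)  y∈ = unique-++-apart xs u x∈ y∈

linExt-++⇒≰ : ∀ {m} {_≤P_ : Fin m → Fin m → Set} {x y} xs {ys} →
              LinExt _≤P_ (xs ++ ys) → x ∈ xs → y ∈ ys → ¬ (x ≤P y)
linExt-++⇒≰ {_≤P_ = _≤P_} {x} {y} xs {ys} (unique , _ , ordered) x∈ y∈ x≤y =
  <-asym (ordered i j (subst₂ _≤P_ x≡ y≡ x≤y) (λ e → apart (sym (trans y≡ (trans e (sym x≡))))))
         (<-≤-trans (index-++⁺ˡ x∈) (index-++⁺ʳ xs y∈))
  where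
  i j : Fin (length (xs ++ ys))
  i = index (++⁺ʳ xs y∈)
  j = index (++⁺ˡ {ys = ys} x∈)
  x≡ : x ≡ lookup (xs ++ ys) j
  x≡ = lookup-index (++⁺ˡ {ys = ys} x∈)
  y≡ : y ≡ lookup (xs ++ ys) i
  y≡ = lookup-index (++⁺ʳ xs y∈)
  apart : x ≢ y
  apart = unique-++-apart xs unique x∈ y∈

-- Four consecutive presses

every : ∀ {A : Set} → List A → (n : ℕ) → (Vec A n → Bool) → Bool
every vals zero    p = p []
every vals (suc n) p = every vals n λ v → all (λ a → p (a ∷ v)) vals

every-sound : ∀ {A : Set} {vals : List A} → (∀ a → a ∈ vals) →
              ∀ n p → every vals n p ≡ true → ∀ v → T (p v)
every-sound complete zero    p holds []      = ≡true⇒T {p []} holds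
every-sound {vals = vals} complete (suc n) p holds (a ∷ v) =
  All.lookup (all⁺ (λ a → p (a ∷ v)) vals (every-sound complete n (λ v → all (λ a → p (a ∷ v)) vals) holds v))
             (complete a)

bools : List Bool
bools = true ∷ false ∷ []

bools-complete : ∀ b → b ∈ bools
bools-complete true  = here refl
bools-complete false = there (here refl)

-- A symmetric 4 × 4 Boolean matrix, stored as its upper triangle row by row.
Block : Set
Block = Vec Bool 10

slot : Fin 4 → Fin 4 → Fin 10
slot 0F 0F = 0F
slot 0F 1F = 1F
slot 0F 2F = 2F
slot 0F 3F = 3F
slot 1F 0F = 1F
slot 1F 1F = 4F
slot 1F 2F = 5F
slot 1F 3F = 6F
slot 2F 0F = 2F
slot 2F 1F = 5F
slot 2F 2F = 7F
slot 2F 3F = 8F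
slot 3F 0F = 3F
slot 3F 1F = 6F
slot 3F 2F = 8F
slot 3F 3F = 9F

blockAdj : Block → Adj 4
blockAdj b x y = Vec.lookup b (slot x y)

blockOf : ∀ {m} → Adj m → (Fin 4 → Fin m) → Block
blockOf B w = e 0F 0F ∷ e 0F 1F ∷ e 0F 2F ∷ e 0F 3F ∷ e 1F 1F ∷ e 1F 2F ∷ e 1F 3F
            ∷ e 2F 2F ∷ e 2F 3F ∷ e 3F 3F ∷ []
  where
  e : Adj 4
  e = restrict B w

blockAdj-blockOf : ∀ {m} {B : Adj m} → Symmetric B → ∀ w → blockAdj (blockOf B w) ≐ restrict B w
blockAdj-blockOf B-sym w 0F 0F = refl
blockAdj-blockOf B-sym w 0F 1F = refl
blockAdj-blockOf B-sym w 0F 2F = refl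
blockAdj-blockOf B-sym w 0F 3F = refl
blockAdj-blockOf B-sym w 1F 0F = B-sym _ _
blockAdj-blockOf B-sym w 1F 1F = refl
blockAdj-blockOf B-sym w 1F 2F = refl
blockAdj-blockOf B-sym w 1F 3F = refl
blockAdj-blockOf B-sym w 2F 0F = B-sym _ _
blockAdj-blockOf B-sym w 2F 1F = B-sym _ _
blockAdj-blockOf B-sym w 2F 2F = refl
blockAdj-blockOf B-sym w 2F 3F = refl
blockAdj-blockOf B-sym w 3F 0F = B-sym _ _
blockAdj-blockOf B-sym w 3F 1F = B-sym _ _
blockAdj-blockOf B-sym w 3F 2F = B-sym _ _
blockAdj-blockOf B-sym w 3F 3F = refl

rowOf : ∀ {m} → Adj m → (Fin 4 → Fin m) → Fin m → Vec Bool 4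
rowOf B w i = tabulate λ a → B (w a) i

row-entry : ∀ {m} (B : Adj m) w i a → Vec.lookup (rowOf B w i) a ≡ B (w a) i
row-entry B w i a = lookup∘tabulate (λ a → B (w a) i) a

-- A window with two more vertices 0F and 1F in front; r and s are their rows towards the window and
-- e the entry between them.
bordered : Adj 4 → Vec Bool 4 → Vec Bool 4 → Bool → Adj 6
bordered M r s e 0F            0F            = false
bordered M r s e 0F            1F            = e
bordered M r s e 1F            0F            = e
bordered M r s e 1F            1F            = false
bordered M r s e 0F            (suc (suc b)) = Vec.lookup r b
bordered M r s e 1F            (suc (suc b)) = Vec.lookup s b
bordered M r s e (suc (suc a)) 0F            = Vec.lookup r a
bordered M r s e (suc (suc a)) 1F            = Vec.lookup s a
bordered M r s e (suc (suc a)) (suc (suc b)) = M a b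

inner : Fin 4 → Fin 6
inner v = suc (suc v)

bordering : ∀ {m} → (Fin 4 → Fin m) → Fin m → Fin m → Fin 6 → Fin m
bordering w i j 0F            = i
bordering w i j 1F            = j
bordering w i j (suc (suc a)) = w a

-- Pressing window vertices never reads the loops at 0F and 1F, which bordered sets to false.
Apart : Fin 6 → Fin 6 → Set
Apart 0F 0F = ⊥
Apart 1F 1F = ⊥
Apart _  _  = ⊤

bordered-agrees : ∀ {m} {B : Adj m} → Symmetric B → ∀ w i j →
  Agree Apart (restrict B (bordering w i j))
              (bordered (blockAdj (blockOf B w)) (rowOf B w i) (rowOf B w j) (B i j))
bordered-agrees         B-sym w i j 0F            1F            _ = refl
bordered-agrees         B-sym w i j 1F            0F            _ = B-sym j i
bordered-agrees {B = B} B-sym w i j 0F            (suc (suc b)) _ =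
  trans (B-sym i (w b)) (sym (row-entry B w i b))
bordered-agrees {B = B} B-sym w i j 1F            (suc (suc b)) _ =
  trans (B-sym j (w b)) (sym (row-entry B w j b))
bordered-agrees {B = B} B-sym w i j (suc (suc a)) 0F            _ = sym (row-entry B w i a)
bordered-agrees {B = B} B-sym w i j (suc (suc a)) 1F            _ = sym (row-entry B w j a)
bordered-agrees         B-sym w i j (suc (suc a)) (suc (suc b)) _ = sym (blockAdj-blockOf B-sym w a b)

outcome : Adj 6 → List (Fin 4) → Bool
outcome M π = pressSeq M (map inner π) 0F 1F

pressSeq-bordered : ∀ {m} {B : Adj m} → Symmetric B → ∀ w π i j →
  pressSeq B (map w π) i j
    ≡ outcome (bordered (blockAdj (blockOf B w)) (rowOf B w i) (rowOf B w j) (B i j)) π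
pressSeq-bordered {B = B} B-sym w π i j = begin
  pressSeq B (map w π) i j
    ≡⟨ cong (λ vs → pressSeq B vs i j) (map-∘ π) ⟩
  pressSeq B (map (bordering w i j) (map inner π)) i j
    ≡⟨ sym (pressSeq-restrict B (bordering w i j) (map inner π) 0F 1F) ⟩
  pressSeq (restrict B (bordering w i j)) (map inner π) 0F 1F
    ≡⟨ pressSeq-agree (map inner π) (map⁺ (All.universal (λ _ _ _ _ → tt , tt) π))
                      (bordered-agrees B-sym w i j) 0F 1F tt ⟩
  outcome (bordered (blockAdj (blockOf B w)) (rowOf B w i) (rowOf B w j) (B i j)) π ∎
  where open ≡-Reasoning

Mask : Set
Mask = Fin 4 → Fin 4 → Bool

forward : Mask
forward k l = toℕ k <ᵇ toℕ l

identity : List (Fin 4)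
identity = allFin 4

arc : Adj 4 → Fin 4 → Fin 4 → Bool
arc M k l = pressSeq M (take (toℕ k) identity) k l

inverts : Mask → List (Fin 4) → Bool
inverts Ab []      = false
inverts Ab (l ∷ π) = any (λ k → Ab k l) π ∨ inverts Ab π

violates : Mask → Adj 4 → Bool
violates Ab M = any (λ k → any (λ l → forward k l ∧ arc M k l ∧ not (Ab k l)) identity) identity

sameEntry : Adj 4 → List (Fin 4) → Vec Bool 4 → Vec Bool 4 → Bool → Bool
sameEntry M π r s e = not (outcome (bordered M r s e) π xor outcome (bordered M r s e) identity)

sameOutcome : Adj 4 → List (Fin 4) → Bool
sameOutcome M π = every bools 4 λ r → every bools 4 λ s → all (sameEntry M π r s) bools

insertions : ∀ {A : Set} → A → List A → List (List A)
insertions x []       = (x ∷ []) ∷ []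
insertions x (y ∷ ys) = (x ∷ y ∷ ys) ∷ map (y ∷_) (insertions x ys)

permutations : ∀ {A : Set} → List A → List (List A)
permutations []       = [] ∷ []
permutations (x ∷ xs) = concatMap (insertions x) (permutations xs)

refutes : Mask → Adj 4 → List (Fin 4) → Bool
refutes Ab M π = admissible M π ∧ inverts Ab π ∧ sameOutcome M π

blockVerdict : Mask → (Adj 4 → Bool) → Adj 4 → Bool
blockVerdict Ab E M =
  not (admissible M identity) ∨ violates Ab M ∨ E M ∨ any (refutes Ab M) (permutations identity)

windowCheck : Mask → (Adj 4 → Bool) → Bool
windowCheck Ab E = every bools 10 (blockVerdict Ab E ∘ blockAdj)

not-xor⇒≡ : ∀ a b → T (not (a xor b)) → a ≡ b
not-xor⇒≡ true  true  _ = refl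
not-xor⇒≡ false false _ = refl

sameOutcome-sound : ∀ {M π} → T (sameOutcome M π) →
  ∀ r s e → outcome (bordered M r s e) π ≡ outcome (bordered M r s e) identity
sameOutcome-sound {M} {π} holds r s e =
  not-xor⇒≡ _ _ (All.lookup (all⁺ (sameEntry M π r s) bools for-all-e) (bools-complete e))
  where
  for-all-s : T (every bools 4 λ s → all (sameEntry M π r s) bools)
  for-all-s = every-sound bools-complete 4 (λ r → every bools 4 λ s → all (sameEntry M π r s) bools)
                (T⇒≡true {sameOutcome M π} holds) r
  for-all-e : T (all (sameEntry M π r s) bools)
  for-all-e = every-sound bools-complete 4 (λ s → all (sameEntry M π r s) bools)
                (T⇒≡true {every bools 4 λ s → all (sameEntry M π r s) bools} for-all-s) s

inverts-sound : ∀ {Ab} π → T (inverts Ab π) →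
  ∃[ xs ] ∃[ ys ] ∃[ k ] ∃[ l ] π ≡ xs ++ ys × l ∈ xs × k ∈ ys × T (Ab k l)
inverts-sound {Ab} (l ∷ π) holds with Equivalence.to (T-∨ {any (λ k → Ab k l) π}) holds
... | inj₁ found =
  let k , k∈ , lk = find (any⁻ _ π found) in l ∷ [] , π , k , l , refl , here refl , k∈ , lk
... | inj₂ later =
  let xs , ys , k , l′ , eq , l′∈ , k∈ , lk = inverts-sound π later in
  l ∷ xs , ys , k , l′ , cong (l ∷_) eq , there l′∈ , k∈ , lk

violates-sound : ∀ {Ab M} → T (violates Ab M) →
  ∃[ k ] ∃[ l ] toℕ k < toℕ l × arc M k l ≡ true × ¬ T (Ab k l)
violates-sound holds with find (any⁻ _ identity holds)
... | k , _ , holdsₖ with find (any⁻ _ identity holdsₖ)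
... | l , _ , holdsₖₗ =
  let k<l , rest = Equivalence.to T-∧ holdsₖₗ
      kl , ¬ab = Equivalence.to T-∧ rest
  in k , l , <ᵇ⇒< _ _ k<l , T⇒≡true kl , subst T (Equivalence.to T-not-≡ ¬ab)

refutes-sound : ∀ {Ab M} π → T (refutes Ab M π) →
  T (admissible M π) × T (inverts Ab π) × T (sameOutcome M π)
refutes-sound {Ab} {M} π holds =
  let adm , rest = Equivalence.to (T-∧ {admissible M π}) holds
      inv , same = Equivalence.to (T-∧ {inverts Ab π}) rest
  in adm , inv , same

last-disjunct : ∀ {a b c d} → T (not a ∨ b ∨ c ∨ d) → T a → ¬ T b → ¬ T c → T d
last-disjunct {true} {false} {false} holds _ _  _  = holds
last-disjunct {true} {true}          _     _ ¬b _  = ⊥-elim (¬b tt)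
last-disjunct {true} {false} {true}  _     _ _  ¬c = ⊥-elim (¬c tt)

-- The Boolean arguments are given explicitly throughout: inferring them would unfold the search.
blockVerdict-sound : ∀ {Ab E M} → T (blockVerdict Ab E M) →
  T (admissible M identity) → ¬ T (violates Ab M) → ¬ T (E M) → ∃[ π ] T (refutes Ab M π)
blockVerdict-sound {Ab} {E} {M} holds adm ¬violation ¬e =
  let found = last-disjunct {admissible M identity} {violates Ab M} {E M} holds adm ¬violation ¬e
      π , _ , refuted = find (any⁻ (refutes Ab M) (permutations identity) found)
  in π , refuted

windowCheck-sound : ∀ {Ab E} → windowCheck Ab E ≡ true → ∀ b → T (blockVerdict Ab E (blockAdj b))
windowCheck-sound {Ab} {E} holds =
  every-sound bools-complete 10 (blockVerdict Ab E ∘ blockAdj) holds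

window-lemma : ∀ {m} {B : Adj m} → Symmetric B → ∀ w post {Ab E} → windowCheck Ab E ≡ true →
  Successful B (map w identity ++ post) →
  (∀ k l → toℕ k < toℕ l → arc (blockAdj (blockOf B w)) k l ≡ true → T (Ab k l)) →
  (∀ π → T (inverts Ab π) → ¬ Successful B (map w π ++ post)) →
  T (E (blockAdj (blockOf B w)))
window-lemma {B = B} B-sym w post {Ab} {E} holds succ arcs-within no-inversion =
  decidable-stable (T? (E M)) λ ¬e →
  let π , refuted = blockVerdict-sound {Ab} {E} {M} (windowCheck-sound {Ab} {E} holds (blockOf B w))
                      (subst T (sym (admissible≡ identity)) (proj₁ split)) no-violation ¬e
      adm , inv , same = refutes-sound {Ab} {M} π refuted
  in no-inversion π inv
       (successful-++⁺ B (map w π) (subst T (admissible≡ π) adm)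
         (successful-cong (same-graph π same) post (proj₂ split)))
  where
  M : Adj 4
  M = blockAdj (blockOf B w)
  split : T (admissible B (map w identity)) × Successful (pressSeq B (map w identity)) post
  split = successful-++⁻ B (map w identity) succ
  admissible≡ : ∀ π → admissible M π ≡ admissible B (map w π)
  admissible≡ π = trans (admissible-cong (blockAdj-blockOf B-sym w) π) (admissible-restrict B w π)
  no-violation : ¬ T (violates Ab M)
  no-violation v = let k , l , k<l , a , ¬ab = violates-sound {Ab} {M} v in ¬ab (arcs-within k l k<l a)
  same-graph : ∀ π → T (sameOutcome M π) → pressSeq B (map w π) ≐ pressSeq B (map w identity)
  same-graph π same i j = begin
    pressSeq B (map w π) i j                  ≡⟨ pressSeq-bordered B-sym w π i j ⟩
    outcome (bordered M r s (B i j)) π        ≡⟨ sameOutcome-sound {M} {π} same r s (B i j) ⟩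
    outcome (bordered M r s (B i j)) identity ≡⟨ sym (pressSeq-bordered B-sym w identity i j) ⟩
    pressSeq B (map w identity) i j           ∎
    where
    open ≡-Reasoning
    r s : Vec Bool 4
    r = rowOf B w i
    s = rowOf B w j

four-++-drop : ∀ {A : Set} (d : A) xs → 4 ≤ length xs → xs ≡ map (nthOr d xs ∘′ toℕ) identity ++ drop 4 xs
four-++-drop d (a ∷ b ∷ c ∷ e ∷ xs) (s≤s (s≤s (s≤s (s≤s z≤n)))) = refl

-- Positions in σ are 0-based and read as the default vertex d beyond its end; U p q is the entry
-- U[p+1, q+1] of the paper's instruction matrix.
module Schedule {m} (A : Adj m) (A-sym : Symmetric A) (σ : List (Fin m)) (d : Fin m) where

  nth : ℕ → Fin m
  nth = nthOr d σ

  U : ℕ → ℕ → Bool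
  U p q = pressSeq A (take p σ) (nth p) (nth q)

  U⇒⪯ : ∀ {p q} → p ≤ q → q < length σ → U p q ≡ true → PLe A σ (nth q) (nth p)
  U⇒⪯ {p} {q} p≤q q< u with toℕ-preimage (≤-<-trans p≤q q<) | toℕ-preimage q<
  ... | i , refl | j , refl = (i , j , p≤q , lookup≡nthOr d σ i , lookup≡nthOr d σ j , u) ◅ ε

  ⪯⇒precedes : LinExt (PLe A σ) σ → ∀ {p q} → p < length σ → q < length σ →
               PLe A σ (nth q) (nth p) → nth p ≢ nth q → p < q
  ⪯⇒precedes (_ , _ , ordered) p< q< q⪯p p≢q with toℕ-preimage p< | toℕ-preimage q<
  ... | i , refl | j , refl =
    ordered i j (subst₂ (PLe A σ) (sym (lookup≡nthOr d σ j)) (sym (lookup≡nthOr d σ i)) q⪯p)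
            (λ e → p≢q (trans (sym (lookup≡nthOr d σ i)) (trans e (lookup≡nthOr d σ j))))

  module Window (succ : Successful A σ) (extends : ∀ τ → Successful A τ → LinExt (PLe A σ) τ)
                (st : ℕ) (fits : st + 4 ≤ length σ) where

    pre rest post : List (Fin m)
    pre  = take st σ
    rest = drop st σ
    post = drop 4 rest

    B : Adj m
    B = pressSeq A pre

    w : Fin 4 → Fin m
    w k = nthOr d rest (toℕ k)

    rest≡ : rest ≡ map w identity ++ post
    rest≡ = four-++-drop d rest (≤-length-drop st 4 σ fits)

    nth≡w : ∀ (k : Fin 4) → nth (toℕ k + st) ≡ w k
    nth≡w k = trans (cong nth (+-comm (toℕ k) st)) (nthOr-drop d σ st (toℕ k))

    take≡ : ∀ (k : Fin 4) → take (toℕ k + st) σ ≡ pre ++ map w (take (toℕ k) identity)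
    take≡ k = begin
      take (toℕ k + st) σ                          ≡⟨ cong (λ n → take n σ) (+-comm (toℕ k) st) ⟩
      take (st + toℕ k) σ                          ≡⟨ take-+ st (toℕ k) σ ⟩
      pre ++ take (toℕ k) rest                     ≡⟨ cong (λ xs → pre ++ take (toℕ k) xs) rest≡ ⟩
      pre ++ take (toℕ k) (map w identity ++ post) ≡⟨ cong (pre ++_) (take-window k) ⟩
      pre ++ map w (take (toℕ k) identity)         ∎
      where
      open ≡-Reasoning
      take-window : ∀ (k : Fin 4) → take (toℕ k) (map w identity ++ post) ≡ map w (take (toℕ k) identity)
      take-window 0F = refl
      take-window 1F = refl
      take-window 2F = refl
      take-window 3F = refl

    split : T (admissible A pre) × Successful B (map w identity ++ post)
    split = successful-++⁻ A pre
              (subst (Successful A) (trans (sym (take++drop≡id st σ)) (cong (pre ++_) rest≡)) succ)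

    arc≡U : ∀ (k l : Fin 4) → arc (blockAdj (blockOf B w)) k l ≡ U (toℕ k + st) (toℕ l + st)
    arc≡U k l = begin
      arc (blockAdj (blockOf B w)) k l
        ≡⟨ pressSeq-cong (blockAdj-blockOf (pressSeq-symmetric A-sym pre) w) (take (toℕ k) identity) k l ⟩
      pressSeq (restrict B w) (take (toℕ k) identity) k l
        ≡⟨ pressSeq-restrict B w (take (toℕ k) identity) k l ⟩
      pressSeq B (map w (take (toℕ k) identity)) (w k) (w l)
        ≡⟨ cong (λ C → C (w k) (w l)) (sym (pressSeq-++ A pre (map w (take (toℕ k) identity)))) ⟩
      pressSeq A (pre ++ map w (take (toℕ k) identity)) (w k) (w l)
        ≡⟨ entry-cong (sym (take≡ k)) (sym (nth≡w k)) (sym (nth≡w l)) ⟩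
      U (toℕ k + st) (toℕ l + st) ∎
      where
      open ≡-Reasoning
      entry-cong : ∀ {xs ys x x′ y y′} → xs ≡ ys → x ≡ x′ → y ≡ y′ →
                   pressSeq A xs x y ≡ pressSeq A ys x′ y′
      entry-cong refl refl refl = refl

    no-inversion : ∀ {Ab} → (∀ k l → T (Ab k l) → PLe A σ (nth (toℕ l + st)) (nth (toℕ k + st))) →
                   ∀ π → T (inverts Ab π) → ¬ Successful B (map w π ++ post)
    no-inversion genuine π inverted π-succ with inverts-sound π inverted
    ... | xs , ys , k , l , refl , l∈ , k∈ , ab =
      linExt-++⇒≰ {_≤P_ = PLe A σ} (pre ++ map w xs) (subst (LinExt (PLe A σ)) regroup (extends _ τ-succ))
        (∈-++⁺ʳ pre (∈-map⁺ w l∈)) (∈-++⁺ˡ (∈-map⁺ w k∈))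
        (subst₂ (PLe A σ) (nth≡w l) (nth≡w k) (genuine k l ab))
      where
      τ-succ : Successful A (pre ++ (map w (xs ++ ys) ++ post))
      τ-succ = successful-++⁺ A pre (proj₁ split) π-succ
      regroup : pre ++ (map w (xs ++ ys) ++ post) ≡ (pre ++ map w xs) ++ (map w ys ++ post)
      regroup = begin
        pre ++ (map w (xs ++ ys) ++ post)      ≡⟨ cong (λ zs → pre ++ (zs ++ post)) (map-++ w xs ys) ⟩
        pre ++ ((map w xs ++ map w ys) ++ post) ≡⟨ cong (pre ++_) (++-assoc (map w xs) (map w ys) post) ⟩
        pre ++ (map w xs ++ (map w ys ++ post)) ≡⟨ sym (++-assoc pre (map w xs) (map w ys ++ post)) ⟩
        (pre ++ map w xs) ++ (map w ys ++ post) ∎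
        where open ≡-Reasoning

    window-effect : ∀ {Ab E} → windowCheck Ab E ≡ true →
      (∀ k l → toℕ k < toℕ l → U (toℕ k + st) (toℕ l + st) ≡ true → T (Ab k l)) →
      (∀ k l → T (Ab k l) → PLe A σ (nth (toℕ l + st)) (nth (toℕ k + st))) →
      T (E (blockAdj (blockOf B w)))
    window-effect {Ab} {E} holds arcs genuine =
      window-lemma (pressSeq-symmetric A-sym pre) w post {Ab} {E} holds (proj₂ split)
        (λ k l k<l a → arcs k l k<l (trans (sym (arc≡U k l)) a)) (no-inversion genuine)

-- The poset X(n)

two-values : ∀ {c s} → c ≤ s → s < 2 + c → s ≡ c ⊎ s ≡ suc c
two-values c≤s s< with m≤n⇒m<n∨m≡n c≤s
... | inj₂ c≡s = inj₁ (sym c≡s)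
... | inj₁ c<s = inj₂ (≤-antisym (s≤s⁻¹ s<) c<s)

-- The order of X(n) on 0-based elements, so that XLe n s t is toℕ s ⊑[ n ] toℕ t.
_⊑[_]_ : ℕ → ℕ → ℕ → Set
s ⊑[ n ] t = Star (XCover n) (suc t) (suc s)

module XOrder (k : ℕ) where

  infix 4 _↝_ _⊑_

  _↝_ : ℕ → ℕ → Set
  _↝_ = Star (XCover (4 + k))

  _⊑_ : ℕ → ℕ → Set
  s ⊑ t = s ⊑[ 4 + k ] t

  cover-increasing : ∀ {a b} → XCover (4 + k) a b → a < b
  cover-increasing (inj₁ (refl , refl))         = s≤s (s≤s z≤n)
  cover-increasing (inj₂ (inj₁ (refl , refl)))  = s≤s (s≤s (n≤1+n _))
  cover-increasing (inj₂ (inj₂ (_ , _ , refl))) = ≤-refl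

  ↝-increasing : ∀ {a b} → a ↝ b → a ≤ b
  ↝-increasing ε        = ≤-refl
  ↝-increasing (c ◅ cs) = ≤-trans (<⇒≤ (cover-increasing c)) (↝-increasing cs)

  ⊑-antitone : ∀ {s t} → s ⊑ t → t ≤ s
  ⊑-antitone s⊑t = s≤s⁻¹ (↝-increasing s⊑t)

  climb : ∀ {a b} → 2 ≤ a → a ≤ b → b ≤ 3 + k → a ↝ b
  climb 2≤a a≤b b≤ with m≤n⇒m<n∨m≡n a≤b
  ... | inj₂ refl = ε
  climb {b = suc b} 2≤a _ b≤ | inj₁ (s≤s a≤b) =
    climb 2≤a a≤b (≤-trans (n≤1+n b) b≤) ◅◅ (inj₂ (inj₂ (≤-trans 2≤a a≤b , s≤s⁻¹ b≤ , refl)) ◅ ε)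

  reach : ∀ {a b} → 2 ≤ a → a ≤ 2 + k → a ≤ b → b ≤ 4 + k → a ↝ b
  reach 2≤a a≤ a≤b b≤ with m≤n⇒m<n∨m≡n b≤
  ... | inj₁ (s≤s b≤′) = climb 2≤a a≤b b≤′
  ... | inj₂ refl      = climb 2≤a a≤ (n≤1+n _) ◅◅ (inj₂ (inj₁ (refl , refl)) ◅ ε)

  chain-above : ∀ {s t} → 2 ≤ t → t ≤ 1 + k → t < s → s < 4 + k → s ⊑ t
  chain-above 2≤t t≤ t<s s< = reach (≤-trans 2≤t (n≤1+n _)) (s≤s t≤) (<⇒≤ (s≤s t<s)) s<

  tops-above : 1 ≤ k → ∀ {s t} → t < 2 → 2 ≤ s → s < 4 + k → s ⊑ t
  tops-above 1≤k t<2 2≤s s< = to-3 t<2 ◅◅ reach (s≤s (s≤s z≤n)) (s≤s (s≤s 1≤k)) (s≤s 2≤s) s<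
    where
    to-3 : ∀ {t} → t < 2 → suc t ↝ 3
    to-3 {zero}        _                = inj₁ (refl , refl) ◅ ε
    to-3 {suc zero}    _                = inj₂ (inj₂ (≤-refl , s≤s (s≤s z≤n) , refl)) ◅ ε
    to-3 {suc (suc _)} (s≤s (s≤s ()))

  tops-incomparable : ∀ {s t} → s < 2 → t < 2 → s ≢ t → ¬ s ⊑ t
  tops-incomparable s< t< s≢t s⊑t with two-values z≤n s< | two-values z≤n t<
  ... | inj₁ refl | inj₁ refl = s≢t refl
  ... | inj₂ refl | inj₂ refl = s≢t refl
  ... | inj₁ refl | inj₂ refl = <⇒≱ (s≤s z≤n) (⊑-antitone s⊑t)
  ... | inj₂ refl | inj₁ refl with s⊑t
  ...   | inj₁ (_ , refl) ◅ path      = <⇒≱ (s≤s (s≤s (s≤s z≤n))) (↝-increasing path)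
  ...   | inj₂ (inj₁ (() , _)) ◅ _
  ...   | inj₂ (inj₂ (s≤s () , _)) ◅ _

  bottoms-incomparable : ∀ {s t} → 2 + k ≤ s → 2 + k ≤ t → s < 4 + k → t < 4 + k → s ≢ t → ¬ s ⊑ t
  bottoms-incomparable ≤s ≤t s< t< s≢t s⊑t with two-values ≤s s< | two-values ≤t t<
  ... | inj₁ refl | inj₁ refl = s≢t refl
  ... | inj₂ refl | inj₂ refl = s≢t refl
  ... | inj₁ refl | inj₂ refl = <⇒≱ ≤-refl (⊑-antitone s⊑t)
  ... | inj₂ refl | inj₁ refl with s⊑t
  ...   | inj₁ (() , _) ◅ _
  ...   | inj₂ (inj₁ (e , _)) ◅ _      = <-irrefl (sym e) ≤-refl
  ...   | inj₂ (inj₂ (_ , ≤k , _)) ◅ _ = <-irrefl refl ≤k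

two-below : ∀ {a b p} → a < p → b < p → a ≢ b → 2 ≤ p
two-below {zero}  {zero}  _         _         a≢b = ⊥-elim (a≢b refl)
two-below {suc _} {_}     (s≤s a<p) _         _   = s≤s (≤-trans (s≤s z≤n) a<p)
two-below {zero}  {suc _} _         (s≤s b<p) _   = s≤s (≤-trans (s≤s z≤n) b<p)

region : ∀ k x → x < 2 ⊎ (2 ≤ x × x ≤ 1 + k) ⊎ 2 + k ≤ x
region k zero          = inj₁ (s≤s z≤n)
region k (suc zero)    = inj₁ (s≤s (s≤s z≤n))
region k (suc (suc x)) with suc (suc x) ≤? 1 + k
... | yes x≤ = inj₂ (inj₁ (s≤s (s≤s z≤n) , x≤))
... | no  x≰ = inj₂ (inj₂ (≰⇒> x≰))

-- element p is the element of X(4 + k) listed at position p of a linear extension.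
module Extension (k : ℕ) (1≤k : 1 ≤ k) (element : ℕ → ℕ)
  (element< : ∀ p → element p < 4 + k)
  (element-injective : ∀ {p q} → p < 4 + k → q < 4 + k → element p ≡ element q → p ≡ q)
  (element-surjective : ∀ {x} → x < 4 + k → ∃[ p ] p < 4 + k × element p ≡ x)
  (descending : ∀ {p q} → p < 4 + k → q < 4 + k →
                element q ⊑[ 4 + k ] element p → element p ≢ element q → p < q)
  where

  open XOrder k

  N : ℕ
  N = 4 + k

  above⇒before : ∀ {p q s t} → p < N → q < N → element p ≡ t → element q ≡ s → s ⊑ t → t < s → p < q
  above⇒before p< q< refl refl s⊑t t<s = descending p< q< s⊑t (λ e → <-irrefl e t<s)

  chain<N : ∀ {c} → c ≤ 1 + k → c < N
  chain<N c≤ = ≤-<-trans c≤ (s≤s (m≤n+m _ 2))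

  chain-lower : ∀ {c p} → 2 ≤ c → c ≤ 1 + k → p < N → element p ≡ c → c ≤ p
  chain-lower {suc zero} (s≤s ()) _ _ _
  chain-lower {suc (suc zero)} {p} _ _ p< lp =
    let p₀ , p₀< , l₀ = element-surjective {0} (s≤s z≤n)
        p₁ , p₁< , l₁ = element-surjective {1} (s≤s (s≤s z≤n))
    in two-below (above⇒before p₀< p< l₀ lp (above-2 (s≤s z≤n)) (s≤s z≤n))
                 (above⇒before p₁< p< l₁ lp (above-2 (s≤s (s≤s z≤n))) ≤-refl)
                 (λ e → 0≢1+n (trans (sym l₀) (trans (cong element e) l₁)))
    where
    above-2 : ∀ {t} → t < 2 → 2 ⊑ t
    above-2 t<2 = tops-above 1≤k t<2 ≤-refl (s≤s (s≤s (s≤s z≤n)))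
  chain-lower {suc (suc (suc c))} {p} _ c≤ p< lp =
    let c′≤ = ≤-trans (n≤1+n _) c≤
        p′ , p′< , l′ = element-surjective (chain<N c′≤)
    in ≤-trans (s≤s (chain-lower (s≤s (s≤s z≤n)) c′≤ p′< l′))
               (above⇒before p′< p< l′ lp (chain-above (s≤s (s≤s z≤n)) c′≤ ≤-refl (chain<N c≤)) ≤-refl)

  two-above : ∀ {p a b} → p < a → p < b → a < N → b < N → a ≢ b → p ≤ 1 + k
  two-above {p} p<a p<b a< b< a≢b with p ≤? 1 + k
  ... | yes p≤ = p≤
  ... | no  p≰ = ⊥-elim (a≢b (trans (last p<a a<) (sym (last p<b b<))))
    where
    last : ∀ {x} → p < x → x < N → x ≡ 3 + k
    last p<x x< = ≤-antisym (s≤s⁻¹ x<) (≤-trans (s≤s (≰⇒> p≰)) p<x)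

  chain-upper : ∀ d {c p} → c + d ≡ 1 + k → 2 ≤ c → p < N → element p ≡ c → p ≤ c
  chain-upper zero {c} {p} c+0≡ 2≤c p< lp =
    let c≡ = trans (sym (+-identityʳ c)) c+0≡
        q₂ , q₂< , l₂ = element-surjective {2 + k} 2+k<N
        q₃ , q₃< , l₃ = element-surjective {3 + k} ≤-refl
    in subst (p ≤_) (sym c≡)
         (two-above (before (trans lp c≡) q₂< l₂ ≤-refl 2+k<N)
                    (before (trans lp c≡) q₃< l₃ (n≤1+n _) ≤-refl)
                    q₂< q₃< (λ e → 1+n≢n (sym (trans (sym l₂) (trans (cong element e) l₃)))))
    where
    2+k<N : 2 + k < N
    2+k<N = s≤s (n≤1+n (2 + k))
    before : ∀ {q s} → element p ≡ 1 + k → q < N → element q ≡ s → 1 + k < s → s < N → p < q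
    before lp′ q< lq k< s< = above⇒before p< q< lp′ lq (chain-above (s≤s 1≤k) ≤-refl k< s<) k<
  chain-upper (suc d) {c} {p} c+d≡ 2≤c p< lp =
    let c+d≡′ = trans (sym (+-suc c d)) c+d≡
        c< = subst (suc c ≤_) c+d≡′ (m≤m+n (suc c) d)
        q , q< , lq = element-surjective (chain<N c<)
        p<q = above⇒before p< q< lp lq (chain-above 2≤c (≤-trans (n≤1+n c) c<) ≤-refl (chain<N c<)) ≤-refl
    in s≤s⁻¹ (<-≤-trans p<q (chain-upper d c+d≡′ (≤-trans 2≤c (n≤1+n c)) q< lq))

  chain-fixed : ∀ {p} → 2 ≤ p → p ≤ 1 + k → element p ≡ p
  chain-fixed {p} 2≤p p≤ =
    let q , q< , lq = element-surjective (chain<N p≤)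
        q≡p = ≤-antisym (chain-upper (1 + k ∸ p) (m+[n∸m]≡n p≤) 2≤p q< lq) (chain-lower 2≤p p≤ q< lq)
    in subst (λ r → element r ≡ p) q≡p lq

  top-elements : ∀ {p} → p < 2 → element p < 2
  top-elements {p} p<2 with region k (element p)
  ... | inj₁ e<2 = e<2
  ... | inj₂ (inj₁ (2≤e , e≤)) = ⊥-elim (<⇒≱ p<2 (≤-trans 2≤e (chain-lower 2≤e e≤ p< refl)))
    where
    p< : p < N
    p< = ≤-trans p<2 (s≤s (s≤s z≤n))
  ... | inj₂ (inj₂ k≤e) =
    ⊥-elim (<⇒≱ p<2 (<⇒≤ (above⇒before (chain<N (s≤s 1≤k)) p< (chain-fixed ≤-refl (s≤s 1≤k)) refl
                                       (chain-above ≤-refl (s≤s 1≤k) 2<e (element< p)) 2<e)))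
    where
    p< : p < N
    p< = ≤-trans p<2 (s≤s (s≤s z≤n))
    2<e : 2 < element p
    2<e = ≤-trans (s≤s (s≤s 1≤k)) k≤e

  bottom-elements : ∀ {p} → 2 + k ≤ p → p < N → 2 + k ≤ element p
  bottom-elements {p} k≤p p< with region k (element p)
  ... | inj₂ (inj₂ k≤e) = k≤e
  ... | inj₂ (inj₁ (2≤e , e≤)) =
    ⊥-elim (<-irrefl refl (≤-trans k≤p (≤-trans (chain-upper _ (m+[n∸m]≡n e≤) 2≤e p< refl) e≤)))
  ... | inj₁ e<2 =
    ⊥-elim (<-irrefl refl (≤-trans k≤p (<⇒≤ p<1+k)))
    where
    p<1+k : p < 1 + k
    p<1+k = above⇒before p< (chain<N ≤-refl) refl (chain-fixed (s≤s 1≤k) ≤-refl)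
                         (tops-above 1≤k e<2 (s≤s 1≤k) (chain<N ≤-refl)) (≤-trans e<2 (s≤s 1≤k))

  element-lower-bound : ∀ {c q} → c ≤ 2 + k → c ≤ q → 2 ≤ q → q < N → c ≤ element q
  element-lower-bound {c} {q} c≤ c≤q 2≤q q< with region k q
  ... | inj₁ q<2             = ⊥-elim (<⇒≱ q<2 2≤q)
  ... | inj₂ (inj₁ (_ , q≤)) = subst (c ≤_) (sym (chain-fixed 2≤q q≤)) c≤q
  ... | inj₂ (inj₂ k≤q)      = ≤-trans c≤ (bottom-elements k≤q q<)

  comparable : ∀ {p q} → p < q → q < N → 2 ≤ q → p ≤ 1 + k → element q ⊑ element p
  comparable {p} {q} p<q q< 2≤q p≤ with 2 ≤? p
  ... | no  p≱2 = tops-above 1≤k (top-elements (≰⇒> p≱2)) (element-lower-bound (s≤s (s≤s z≤n)) 2≤q 2≤q q<)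
                             (element< q)
  ... | yes 2≤p = subst (element q ⊑_) (sym (chain-fixed 2≤p p≤))
                    (chain-above 2≤p p≤ (element-lower-bound (s≤s p≤) p<q 2≤q q<) (element< q))

  tops-unordered : ¬ element 1 ⊑ element 0
  tops-unordered = tops-incomparable (top-elements ≤-refl) (top-elements (s≤s z≤n))
    (1+n≢0 ∘ element-injective (s≤s (s≤s z≤n)) (s≤s z≤n))

  bottoms-unordered : ¬ element (3 + k) ⊑ element (2 + k)
  bottoms-unordered = bottoms-incomparable (bottom-elements (n≤1+n _) ≤-refl) (bottom-elements ≤-refl 2+k<N)
    (element< _) (element< _) (1+n≢n ∘ element-injective ≤-refl 2+k<N)
    where
    2+k<N : 2 + k < N
    2+k<N = s≤s (n≤1+n (2 + k))

module Realisation (k : ℕ) (G : OSPGraph) (σ : List (Fin (m G))) (succ : Successful (adj G) σ)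
  (f : Fin (m G) → Fin (4 + k)) (f-bijective : Bijective _≡_ _≡_ f)
  (iso : ∀ a b → PLe (adj G) σ a b ⇔ XLe (4 + k) (f a) (f b))
  (extends : ∀ τ → Successful (adj G) τ → LinExt (PLe (adj G) σ) τ)
  where

  open XOrder k

  f-injective : ∀ {a b} → f a ≡ f b → a ≡ b
  f-injective = proj₁ f-bijective

  vertex : Fin (4 + k) → Fin (m G)
  vertex e = proj₁ (proj₂ f-bijective e)

  f∘vertex : ∀ e → f (vertex e) ≡ e
  f∘vertex e = proj₂ (proj₂ f-bijective e) refl

  open Schedule (adj G) (adjSym G) σ (vertex zero) public

  σ-extension : LinExt (PLe (adj G) σ) σ
  σ-extension = extends σ succ

  all-in : ∀ v → v ∈ σ
  all-in = proj₁ (proj₂ σ-extension)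

  position : Fin (4 + k) → Fin (length σ)
  position e = index (all-in (vertex e))

  vertex≡ : ∀ e → vertex e ≡ lookup σ (position e)
  vertex≡ e = lookup-index (all-in (vertex e))

  length≡ : length σ ≡ 4 + k
  length≡ = cantor-schröder-bernstein {f = f ∘ lookup σ} {g = position}
    (λ e → unique⇒lookup-injective (proj₁ σ-extension) _ _ (f-injective e))
    (λ {e} {e′} eq → begin
      e             ≡⟨ sym (f∘vertex e) ⟩
      f (vertex e)  ≡⟨ cong f (trans (vertex≡ e) (trans (cong (lookup σ) eq) (sym (vertex≡ e′)))) ⟩
      f (vertex e′) ≡⟨ f∘vertex e′ ⟩
      e′            ∎)
    where open ≡-Reasoning

  in-σ : ∀ {p} → p < 4 + k → p < length σ
  in-σ {p} = subst (p <_) (sym length≡)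

  element : ℕ → ℕ
  element p = toℕ (f (nth p))

  element< : ∀ p → element p < 4 + k
  element< p = toℕ<n (f (nth p))

  element-injective : ∀ {p q} → p < 4 + k → q < 4 + k → element p ≡ element q → p ≡ q
  element-injective p< q< eq with toℕ-preimage (in-σ p<) | toℕ-preimage (in-σ q<)
  ... | i , refl | j , refl = cong toℕ (unique⇒lookup-injective (proj₁ σ-extension) i j
    (trans (lookup≡nthOr _ σ i) (trans (f-injective (toℕ-injective eq)) (sym (lookup≡nthOr _ σ j)))))

  element-surjective : ∀ {x} → x < 4 + k → ∃[ p ] p < 4 + k × element p ≡ x
  element-surjective {x} x< = toℕ i , subst (toℕ i <_) length≡ (toℕ<n i) , (begin
    toℕ (f (nth (toℕ i))) ≡⟨ cong (toℕ ∘ f) (sym (lookup≡nthOr _ σ i)) ⟩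
    toℕ (f (lookup σ i))  ≡⟨ cong (toℕ ∘ f) (sym (vertex≡ e)) ⟩
    toℕ (f (vertex e))    ≡⟨ cong toℕ (f∘vertex e) ⟩
    toℕ e                 ≡⟨ toℕ-fromℕ< x< ⟩
    x                     ∎)
    where
    open ≡-Reasoning
    e : Fin (4 + k)
    e = fromℕ< x<
    i : Fin (length σ)
    i = position e

  descending : ∀ {p q} → p < 4 + k → q < 4 + k → element q ⊑ element p → element p ≢ element q → p < q
  descending p< q< q⊑p element≢ = ⪯⇒precedes σ-extension (in-σ p<) (in-σ q<)
    (Equivalence.from (iso _ _) q⊑p) (element≢ ∘ cong (toℕ ∘ f))

  fits : ∀ {st} → st ≤ k → st + 4 ≤ length σ
  fits {st} st≤k = subst (st + 4 ≤_) (trans (+-comm k 4) (sym length≡)) (+-monoˡ-≤ 4 st≤k)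

  window-position< : ∀ {st} → st ≤ k → (j : Fin 4) → toℕ j + st < 4 + k
  window-position< {st} st≤k j = ≤-trans (+-monoˡ-< st (toℕ<n j)) (+-monoʳ-≤ 4 st≤k)

  module W {st} (st≤k : st ≤ k) = Window succ extends st (fits st≤k)

  windowBlock : ∀ {st} → st ≤ k → Adj 4
  windowBlock st≤k = blockAdj (blockOf (W.B st≤k) (W.w st≤k))

  labelled-window : ∀ {st} (st≤k : st ≤ k) {Ab E} → windowCheck Ab E ≡ true →
    (∀ i j → toℕ i < toℕ j → element (toℕ j + st) ⊑ element (toℕ i + st) → T (Ab i j)) →
    (∀ i j → T (Ab i j) → element (toℕ j + st) ⊑ element (toℕ i + st)) →
    T (E (windowBlock st≤k))
  labelled-window {st} st≤k {Ab} {E} holds in-mask ordered = W.window-effect st≤k {Ab} {E} holds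
    (λ i j i<j u → in-mask i j i<j
       (Equivalence.to (iso _ _) (U⇒⪯ (<⇒≤ (+-monoˡ-< st i<j)) (in-σ (window-position< st≤k j)) u)))
    (λ i j t → Equivalence.from (iso _ _) (ordered i j t))

  window-arc : ∀ {st} (st≤k : st ≤ k) (i j : Fin 4) →
    T (arc (windowBlock st≤k) i j) → U (toℕ i + st) (toℕ j + st) ≡ true
  window-arc st≤k i j t = trans (sym (W.arc≡U st≤k i j)) (T⇒≡true {arc (windowBlock st≤k) i j} t)

-- The case n ≥ 5

-- startMask omits only the pair (0, 1) of a window and tailMask only the pair (2, 3).
startMask midMask tailMask : Mask
startMask i j = forward i j ∧ (1 <ᵇ toℕ j)
midMask       = forward
tailMask i j  = forward i j ∧ (toℕ i <ᵇ 2)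

startEffect midEffect tailEffect : Adj 4 → Bool
startEffect M = arc M 1F 3F
midEffect M   = not (arc M 0F 2F) ∨ arc M 1F 3F
tailEffect M  = not (arc M 0F 2F)

start-check : windowCheck startMask startEffect ≡ true
start-check = refl

mid-check : windowCheck midMask midEffect ≡ true
mid-check = refl

tail-check : windowCheck tailMask tailEffect ≡ true
tail-check = refl

midEffect-sound : ∀ M → T (midEffect M) → arc M 0F 2F ≡ true → T (arc M 1F 3F)
midEffect-sound M effect arc02 with arc M 0F 2F
midEffect-sound M effect refl | true = effect

tailEffect-sound : ∀ M → T (tailEffect M) → arc M 0F 2F ≡ false
tailEffect-sound M effect with arc M 0F 2F
... | false = refl

first-pair : ∀ {i j : ℕ} → i < j → j ≤ 1 → i ≡ 0 × j ≡ 1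
first-pair (s≤s z≤n) (s≤s z≤n) = refl , refl

forward⇒< : ∀ {i j : Fin 4} → T (forward i j) → toℕ i < toℕ j
forward⇒< {i} {j} = <ᵇ⇒< (toℕ i) (toℕ j)

earlier≤2 : ∀ {i j : Fin 4} → toℕ i < toℕ j → toℕ i ≤ 2
earlier≤2 {j = j} i<j = s≤s⁻¹ (≤-trans i<j (s≤s⁻¹ (toℕ<n j)))

last-pair : ∀ {i : Fin 4} (j : Fin 4) → toℕ i < toℕ j → 2 ≤ toℕ i → toℕ i ≡ 2 × toℕ j ≡ 3
last-pair {i} j i<j 2≤i = i≡2 , ≤-antisym (s≤s⁻¹ (toℕ<n j)) (subst (_< toℕ j) i≡2 i<j)
  where
  i≡2 : toℕ i ≡ 2
  i≡2 = ≤-antisym (earlier≤2 {i} {j} i<j) 2≤i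

module Long (k : ℕ) (1≤k : 1 ≤ k) (G : OSPGraph) (σ : List (Fin (m G))) (succ : Successful (adj G) σ)
  (f : Fin (m G) → Fin (4 + k)) (f-bijective : Bijective _≡_ _≡_ f)
  (iso : ∀ a b → PLe (adj G) σ a b ⇔ XLe (4 + k) (f a) (f b))
  (extends : ∀ τ → Successful (adj G) τ → LinExt (PLe (adj G) σ) τ)
  where

  open Realisation k G σ succ f f-bijective iso extends
  open XOrder k
  open Extension k 1≤k element element< element-injective element-surjective descending

  window-ordered : ∀ {st} (st≤k : st ≤ k) {i j : Fin 4} → toℕ i < toℕ j →
    2 ≤ toℕ j + st → toℕ i + st ≤ 1 + k → element (toℕ j + st) ⊑ element (toℕ i + st)
  window-ordered {st} st≤k {j = j} i<j = comparable (+-monoˡ-< st i<j) (window-position< st≤k j)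

  start : U 1 3 ≡ true
  start = window-arc z≤n 1F 3F (labelled-window z≤n {startMask} {startEffect} start-check in-mask ordered)
    where
    in-mask : ∀ i j → toℕ i < toℕ j → element (toℕ j + 0) ⊑ element (toℕ i + 0) → T (startMask i j)
    in-mask i j i<j j⊑i with 1 <? toℕ j
    ... | yes 1<j = Equivalence.from T-∧ (<⇒<ᵇ i<j , <⇒<ᵇ 1<j)
    ... | no  1≮j with first-pair i<j (≮⇒≥ 1≮j)
    ...   | i≡0 , j≡1 =
      ⊥-elim (tops-unordered (subst₂ (λ a b → element (a + 0) ⊑ element (b + 0)) j≡1 i≡0 j⊑i))
    ordered : ∀ i j → T (startMask i j) → element (toℕ j + 0) ⊑ element (toℕ i + 0)
    ordered i j t =
      let i<j , 1<j = Equivalence.to (T-∧ {forward i j}) t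
      in window-ordered z≤n (forward⇒< {i} {j} i<j) (≤-trans (<ᵇ⇒< 1 _ 1<j) (m≤m+n _ 0))
                        (≤-trans (+-monoˡ-≤ 0 (earlier≤2 (forward⇒< {i} {j} i<j))) (s≤s 1≤k))

  mid : ∀ {st} → 1 ≤ st → st < k → U st (2 + st) ≡ true → U (1 + st) (3 + st) ≡ true
  mid {st} 1≤st st<k u = window-arc st≤k 1F 3F
    (midEffect-sound (windowBlock st≤k)
       (labelled-window st≤k {midMask} {midEffect} mid-check in-mask ordered)
       (trans (W.arc≡U st≤k 0F 2F) u))
    where
    st≤k : st ≤ k
    st≤k = <⇒≤ st<k
    in-mask : ∀ i j → toℕ i < toℕ j → element (toℕ j + st) ⊑ element (toℕ i + st) → T (midMask i j)
    in-mask i j i<j _ = <⇒<ᵇ i<j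
    ordered : ∀ i j → T (midMask i j) → element (toℕ j + st) ⊑ element (toℕ i + st)
    ordered i j t =
      let i<j = forward⇒< {i} {j} t
      in window-ordered st≤k i<j (+-mono-≤ (≤-trans (s≤s z≤n) i<j) 1≤st)
                        (≤-trans (+-monoˡ-≤ st (earlier≤2 i<j)) (s≤s st<k))

  tail : U k (2 + k) ≡ false
  tail = trans (sym (W.arc≡U ≤-refl 0F 2F)) no-arc
    where
    in-mask : ∀ i j → toℕ i < toℕ j → element (toℕ j + k) ⊑ element (toℕ i + k) → T (tailMask i j)
    in-mask i j i<j j⊑i with toℕ i <? 2
    ... | yes i<2 = Equivalence.from T-∧ (<⇒<ᵇ i<j , <⇒<ᵇ i<2)
    ... | no  i≮2 with last-pair {i} j i<j (≮⇒≥ i≮2)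
    ...   | i≡2 , j≡3 =
      ⊥-elim (bottoms-unordered (subst₂ (λ a b → element (a + k) ⊑ element (b + k)) j≡3 i≡2 j⊑i))
    ordered : ∀ i j → T (tailMask i j) → element (toℕ j + k) ⊑ element (toℕ i + k)
    ordered i j t =
      let i<j′ , i<2 = Equivalence.to (T-∧ {forward i j}) t
          i<j = forward⇒< {i} {j} i<j′
      in window-ordered ≤-refl i<j (+-mono-≤ (≤-trans (s≤s z≤n) i<j) 1≤k)
                        (+-monoˡ-≤ k (s≤s⁻¹ (<ᵇ⇒< _ 2 i<2)))
    no-arc : arc (windowBlock ≤-refl) 0F 2F ≡ false
    no-arc = tailEffect-sound (windowBlock ≤-refl)
               (labelled-window ≤-refl {tailMask} {tailEffect} tail-check in-mask ordered)

  climbing : ∀ j → 1 ≤ j → j ≤ k → U j (2 + j) ≡ true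
  climbing (suc zero)    _ _  = start
  climbing (suc (suc j)) _ j< = mid (s≤s z≤n) j< (climbing (suc j) (s≤s z≤n) (≤-trans (n≤1+n _) j<))

  impossible : ⊥
  impossible = true≢false (trans (sym (climbing k 1≤k ≤-refl)) tail)
    where
    true≢false : true ≢ false
    true≢false ()

-- The case n = 4

x4-above : Fin 4 → Fin 4 → Bool
x4-above 0F 2F            = true
x4-above 1F (suc (suc _)) = true
x4-above _  _             = false

labelMask : Vec (Fin 4) 4 → Mask
labelMask ℓ i j = x4-above (Vec.lookup ℓ i) (Vec.lookup ℓ j)

clash : Vec (Fin 4) 4 → Fin 4 → Fin 4 → Bool
clash ℓ i j =
  forward i j ∧ (⌊ Vec.lookup ℓ i ≟ Vec.lookup ℓ j ⌋ ∨ x4-above (Vec.lookup ℓ j) (Vec.lookup ℓ i))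

misordered : Vec (Fin 4) 4 → Bool
misordered ℓ = any (λ i → any (clash ℓ i) identity) identity

-- For n = 4 the window is all of σ, so the search also ranges over the labellings ℓ of its
-- positions by elements of X(4), skipping those that are not linear extensions.
x4Verdict : Vec (Fin 4) 4 → Bool
x4Verdict ℓ = misordered ℓ ∨ windowCheck (labelMask ℓ) (λ _ → false)

x4-check : every (allFin 4) 4 x4Verdict ≡ true
x4-check = refl

x4Verdict-sound : ∀ ℓ → T (x4Verdict ℓ) → ¬ T (misordered ℓ) →
                  windowCheck (labelMask ℓ) (λ _ → false) ≡ true
x4Verdict-sound ℓ verdict well-ordered = T⇒≡true
  ([ ⊥-elim ∘ well-ordered , (λ passes → passes) ]′
     (Equivalence.to (T-∨ {misordered ℓ} {windowCheck (labelMask ℓ) (λ _ → false)}) verdict))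

module _ where

  open XOrder 0

  x4-above-sound : ∀ s t → T (x4-above t s) → toℕ s ⊑ toℕ t
  x4-above-sound 2F 0F _ = inj₁ (refl , refl) ◅ ε
  x4-above-sound 2F 1F _ = inj₂ (inj₂ (≤-refl , ≤-refl , refl)) ◅ ε
  x4-above-sound 3F 1F _ = inj₂ (inj₁ (refl , refl)) ◅ ε
  x4-above-sound 0F 0F ()
  x4-above-sound 1F 0F ()
  x4-above-sound 3F 0F ()
  x4-above-sound 0F 1F ()
  x4-above-sound 1F 1F ()
  x4-above-sound _  (suc (suc _)) ()

  ¬3⊑0 : ¬ 3 ⊑ 0
  ¬3⊑0 (inj₁ (_ , refl) ◅ inj₁ (() , _) ◅ _)
  ¬3⊑0 (inj₁ (_ , refl) ◅ inj₂ (inj₁ (() , _)) ◅ _)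
  ¬3⊑0 (inj₁ (_ , refl) ◅ inj₂ (inj₂ (_ , s≤s (s≤s ()) , _)) ◅ _)
  ¬3⊑0 (inj₂ (inj₁ (() , _)) ◅ _)
  ¬3⊑0 (inj₂ (inj₂ (s≤s () , _)) ◅ _)

  x4-above-complete : ∀ s t → toℕ s ⊑ toℕ t → s ≢ t → T (x4-above t s)
  x4-above-complete s t s⊑t s≢t with m≤n⇒m<n∨m≡n (⊑-antitone s⊑t)
  ... | inj₂ t≡s = ⊥-elim (s≢t (toℕ-injective (sym t≡s)))
  ... | inj₁ t<s = strictly-below s t t<s s⊑t
    where
    strictly-below : ∀ s t → toℕ t < toℕ s → toℕ s ⊑ toℕ t → T (x4-above t s)
    strictly-below 2F 0F _ _   = tt
    strictly-below 2F 1F _ _   = tt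
    strictly-below 3F 1F _ _   = tt
    strictly-below 1F 0F _ 1⊑0 = ⊥-elim (tops-incomparable ≤-refl (s≤s z≤n) (λ ()) 1⊑0)
    strictly-below 3F 2F _ 3⊑2 =
      ⊥-elim (bottoms-incomparable (s≤s (s≤s z≤n)) ≤-refl ≤-refl (s≤s (s≤s (s≤s z≤n))) (λ ()) 3⊑2)
    strictly-below 3F 0F _ 3⊑0 = ⊥-elim (¬3⊑0 3⊑0)
    strictly-below 0F _             ()                   _
    strictly-below 1F (suc _)       (s≤s ())             _
    strictly-below 2F (suc (suc _)) (s≤s (s≤s ()))       _
    strictly-below 3F 3F            (s≤s (s≤s (s≤s ()))) _

module Smallest (G : OSPGraph) (σ : List (Fin (m G))) (succ : Successful (adj G) σ)
  (f : Fin (m G) → Fin 4) (f-bijective : Bijective _≡_ _≡_ f)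
  (iso : ∀ a b → PLe (adj G) σ a b ⇔ XLe 4 (f a) (f b))
  (extends : ∀ τ → Successful (adj G) τ → LinExt (PLe (adj G) σ) τ)
  where

  open Realisation 0 G σ succ f f-bijective iso extends
  open XOrder 0

  labelling : Vec (Fin 4) 4
  labelling = tabulate λ i → f (nth (toℕ i + 0))

  labelling≡ : ∀ i → toℕ (Vec.lookup labelling i) ≡ element (toℕ i + 0)
  labelling≡ i = cong toℕ (lookup∘tabulate (λ i → f (nth (toℕ i + 0))) i)

  relabel : ∀ i j → toℕ (Vec.lookup labelling j) ⊑ toℕ (Vec.lookup labelling i) →
            element (toℕ j + 0) ⊑ element (toℕ i + 0)
  relabel i j = subst₂ _⊑_ (labelling≡ j) (labelling≡ i)

  unlabel : ∀ i j → element (toℕ j + 0) ⊑ element (toℕ i + 0) →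
            toℕ (Vec.lookup labelling j) ⊑ toℕ (Vec.lookup labelling i)
  unlabel i j = subst₂ _⊑_ (sym (labelling≡ j)) (sym (labelling≡ i))

  elements-apart : ∀ {i j : Fin 4} → toℕ i < toℕ j → element (toℕ i + 0) ≢ element (toℕ j + 0)
  elements-apart {i} {j} i<j e =
    <-irrefl (element-injective (window-position< z≤n i) (window-position< z≤n j) e) (+-monoˡ-< 0 i<j)

  labels-apart : ∀ {i j : Fin 4} → toℕ i < toℕ j → Vec.lookup labelling i ≢ Vec.lookup labelling j
  labels-apart {i} {j} i<j e =
    elements-apart i<j (trans (sym (labelling≡ i)) (trans (cong toℕ e) (labelling≡ j)))

  well-ordered : ¬ T (misordered labelling)
  well-ordered bad =
    let i , _ , bad-i  = find (any⁻ (λ i → any (clash labelling i) identity) identity bad)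
        j , _ , bad-ij = find (any⁻ (clash labelling i) identity bad-i)
        i<j′ , clashing = Equivalence.to (T-∧ {forward i j}) bad-ij
        i<j = forward⇒< {i} {j} i<j′
    in [ (λ same → labels-apart i<j (toWitness same))
       , (λ above → <-asym (+-monoˡ-< 0 i<j)
           (descending (window-position< z≤n j) (window-position< z≤n i)
              (relabel j i (x4-above-sound (Vec.lookup labelling i) (Vec.lookup labelling j) above))
              (elements-apart i<j ∘ sym)))
       ]′ (Equivalence.to (T-∨ {⌊ Vec.lookup labelling i ≟ Vec.lookup labelling j ⌋}) clashing)

  impossible : ⊥
  impossible = labelled-window z≤n {labelMask labelling} {λ _ → false}
    (x4Verdict-sound labelling verdict well-ordered) in-mask ordered
    where
    verdict : T (x4Verdict labelling)
    verdict = every-sound {vals = allFin 4} ∈-allFin 4 x4Verdict x4-check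
                labelling
    in-mask : ∀ i j → toℕ i < toℕ j → element (toℕ j + 0) ⊑ element (toℕ i + 0) → T (labelMask labelling i j)
    in-mask i j i<j j⊑i =
      x4-above-complete (Vec.lookup labelling j) (Vec.lookup labelling i) (unlabel i j j⊑i) (labels-apart i<j ∘ sym)
    ordered : ∀ i j → T (labelMask labelling i j) → element (toℕ j + 0) ⊑ element (toℕ i + 0)
    ordered i j above = relabel i j (x4-above-sound (Vec.lookup labelling j) (Vec.lookup labelling i) above)

mainTheorem10 : ∀ n → 4 ≤ n → ¬ Autonomous n (XLe n)
mainTheorem10 (suc (suc (suc (suc zero)))) (s≤s (s≤s (s≤s (s≤s z≤n))))
  (G , _ , σ , succ , (f , f-bijective , iso) , Σ≡LinExt) =
  Smallest.impossible G σ succ f f-bijective iso (λ τ → Equivalence.to (Σ≡LinExt τ))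
mainTheorem10 (suc (suc (suc (suc (suc k))))) (s≤s (s≤s (s≤s (s≤s z≤n))))
  (G , _ , σ , succ , (f , f-bijective , iso) , Σ≡LinExt) =
  Long.impossible (suc k) (s≤s z≤n) G σ succ f f-bijective iso (λ τ → Equivalence.to (Σ≡LinExt τ))
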